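{- Let $n\ge 3$ and let $C_n$ be the cycle on vertices $v_1,\dots,v_n$. Then: (i) if $\vec C$ is an orientation of $C_n$ with no source and no sink (a directed cycle), then $mag(\vec C)=2$; (ii) if $n$ is even and $\vec C$ is an orientation with exactly one source and exactly one sink, such that the two directed paths from the source to the sink both have length $n/2$, then $mag(\vec C)=4$; (iii) if $\vec C$ is an orientation with exactly one source and exactly one sink, such that the two directed paths from the source to the sink have lengths $d$ and $n-d$ with $d\ne n/2$, then $mag(\vec C)=3$; (iv) if $\vec C$ is an orientation with more than one source and more than one sink, then $mag(\vec C)$ equals the number of sources and sinks of $\vec C$.
   Context: A source is a vertex with no in-neighbour, a sink a vertex with no out-neighbour. Two distinct vertices $x,y$ monitor an arc $a$ if $a$ lies on every shortest directed path from $x$ to $y$, or on every shortest directed path from $y$ to $x$. A monitoring arc-geodetic set (MAG-set) is a vertex set $M$ such that every arc is monitored by some pair of distinct vertices of $M$; $mag(\vec G)$ is the minimum size of an MAG-set. -}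

module Defs where

open import Data.Nat using (ℕ; zero; suc; _≤_; _%_)
open import Data.Nat.DivMod using (m%n<n)
open import Data.Fin using (Fin; toℕ; fromℕ<)
open import Data.Fin.Subset using (Subset; _∈_; ∣_∣)
open import Data.Bool using (Bool; true; false)
open import Data.List using (List; []; _∷_)
open import Data.List.Relation.Unary.Unique.Propositional using (Unique)
open import Data.Product using (Σ; ∃; ∃-syntax; _×_; proj₁)
open import Data.Sum using (_⊎_)
open import Relation.Binary.PropositionalEquality using (_≡_; _≢_)
open import Relation.Nullary using (¬_)

module _ {n : ℕ} (E : Fin n → Fin n → Set) where

  data Walk : Fin n → Fin n → ℕ → Set where
    []  : ∀ {x} → Walk x x 0
    _∷_ : ∀ {x y z k} → E x y → Walk y z k → Walk x z (suc k)

  verts : ∀ {x y k} → Walk x y k → List (Fin n)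
  verts ([] {x}) = x ∷ []
  verts (_∷_ {x} e w) = x ∷ verts w

  Path : Fin n → Fin n → ℕ → Set
  Path x y k = Σ (Walk x y k) (λ w → Unique (verts w))

  data ArcOn (u v : Fin n) : ∀ {x y k} → Walk x y k → Set where
    here  : ∀ {z k} (e : E u v) (w : Walk v z k) → ArcOn u v (e ∷ w)
    there : ∀ {x y z k} (e : E x y) {w : Walk y z k} → ArcOn u v w → ArcOn u v (e ∷ w)

  Shortest : ∀ {x y k} → Path x y k → Set
  Shortest {x} {y} {k} _ = ∀ k' → Path x y k' → k ≤ k'

  OnAllShortest : Fin n → Fin n → Fin n → Fin n → Set
  OnAllShortest x y u v =
    (∃[ k ] Path x y k) ×
    (∀ k (p : Path x y k) → Shortest p → ArcOn u v (proj₁ p))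

  Monitors : Fin n → Fin n → Fin n → Fin n → Set
  Monitors x y u v = x ≢ y × (OnAllShortest x y u v ⊎ OnAllShortest y x u v)

  IsMAGSet : Subset n → Set
  IsMAGSet M = ∀ u v → E u v →
    ∃[ x ] ∃[ y ] (x ∈ M × y ∈ M × Monitors x y u v)

  MagIs : ℕ → Set
  MagIs m = (Σ (Subset n) (λ M → IsMAGSet M × ∣ M ∣ ≡ m))
          × (∀ M → IsMAGSet M → m ≤ ∣ M ∣)

  IsSource : Fin n → Set
  IsSource v = ∀ u → ¬ E u v

  IsSink : Fin n → Set
  IsSink v = ∀ w → ¬ E v w

  UniqueSource : Fin n → Set
  UniqueSource s = IsSource s × (∀ x → IsSource x → x ≡ s)

  UniqueSink : Fin n → Set
  UniqueSink t = IsSink t × (∀ x → IsSink x → x ≡ t)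

-- The cycle C_n on Fin n: edges {i , i+1 mod n}, i : Fin n.
-- An orientation assigns to edge i a Bool:
--   true  : arc i → i+1,   false : arc i+1 → i.

next : ∀ {n} → Fin n → Fin n
next {suc n} i = fromℕ< (m%n<n (suc (toℕ i)) (suc n))

data CArc {n : ℕ} (o : Fin n → Bool) : Fin n → Fin n → Set where
  fwd : ∀ i → o i ≡ true  → CArc o i (next i)
  bwd : ∀ i → o i ≡ false → CArc o (next i) i

module Submission where

-- A walk in an oriented cycle can never turn back (its second arc would retrace the edge
-- of the first), so it runs straight forwards or straight backwards round the cycle.
-- Between two vertices there are thus at most two candidate shortest paths, and an arc
-- lying on a maximal forward run is monitored by the two ends of the run unless the rest
-- of the cycle is a backward run that is at most as long.  Negating the orientation
-- reverses every arc, swaps sources with sinks and preserves monitoring, so only forward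
-- arcs need an argument.  This yields the MAG-sets {v, v+1} for a directed cycle,
-- {s, s+1, t, t+1} and {s, t, t+1} (the shorter side running forwards) for a unique
-- source s and sink t, and the set of all sources and sinks otherwise.
-- Conversely the arc leaving a source, or entering a sink, can only be monitored by a pair
-- containing that vertex.  With a unique source s and sink t, an arc leaving s that is
-- avoided by some shortest s–t path is monitored by s and a vertex other than t; the two
-- arcs leaving s give one such extra vertex, or two distinct ones when both s–t paths are
-- shortest.

open import Defs
open import Data.Bool as Bool using (Bool; true; false; not)
open import Data.Bool.Properties using (not-injective)
open import Data.Empty using (⊥-elim)
open import Data.Fin as Fin using (Fin; toℕ) renaming (zero to fzero)
open import Data.Fin.Properties using (toℕ-fromℕ<; toℕ-injective; toℕ<n) renaming (_≟_ to _≟ᶠ_)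
open import Data.Fin.Subset using (Subset; _∈_; _⊆_; ∣_∣; inside; outside) renaming (⊥ to ∅)
open import Data.Fin.Subset.Properties
  using (x∈p∧x≢y⇒x∈p-y; x∈p⇒∣p-x∣<∣p∣; p⊆q⇒∣p∣≤∣q∣; ∣⊥∣≡0)
open import Data.List as List using (List; []; _∷_; foldr; applyUpTo; applyDownFrom; reverse)
open import Data.List.Properties using (applyUpTo-∷ʳ; unfold-reverse)
open import Data.List.Membership.Propositional using () renaming (_∈_ to _∈ₗ_)
open import Data.List.Relation.Unary.All as All using (All; []; _∷_)
open import Data.List.Relation.Unary.Any using (here; there)
open import Data.List.Relation.Unary.AllPairs using ([]; _∷_)
open import Data.List.Relation.Unary.Unique.Propositional using (Unique)
open import Data.List.Relation.Unary.Unique.Propositional.Properties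
  using (applyUpTo⁺₁; applyDownFrom⁺₁)
open import Data.Nat
  using (ℕ; zero; suc; pred; _+_; _*_; _/_; _∸_; _%_; _≤_; _<_; _<?_; z≤n; s≤s; z<s; >-nonZero)
open import Data.Nat.DivMod using (%-distribˡ-+; m%n%n≡m%n; m<n⇒m%n≡m; [m+n]%n≡m%n; m%n<n)
open import Data.Nat.Properties
open import Data.Product using (Σ; Σ-syntax; ∃-syntax; _×_; _,_; proj₁; proj₂)
open import Data.Sum as Sum using (_⊎_; inj₁; inj₂; [_,_]′)
open import Data.Vec using (_∷_; _[_]≔_)
open import Data.Vec.Properties using ([]≔-updates; []≔-minimal)
open import Function using (_∘_; id)
open import Function.Bundles using (_⇔_; Equivalence)
open import Relation.Binary.Definitions using (tri<; tri≈; tri>)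
open import Relation.Binary.PropositionalEquality
open import Relation.Nullary using (¬_; Dec; yes; no; contradiction)
open import Relation.Nullary.Decidable using (_×-dec_; _⊎-dec_)

true≢false : ∀ {b} → b ≡ true → b ≢ false
true≢false refl ()

-- Finite subsets

fromList : ∀ {n} → List (Fin n) → Subset n
fromList = foldr (λ x p → p [ x ]≔ inside) ∅

fromList-⊇ : ∀ {n} (xs : List (Fin n)) → All (_∈ fromList xs) xs
fromList-⊇ xs = All.tabulate (∈-fromList⁺ xs)
  where
  ∈-fromList⁺ : ∀ {x} xs → x ∈ₗ xs → x ∈ fromList xs
  ∈-fromList⁺ (y ∷ ys) (here refl) = []≔-updates (fromList ys) y
  ∈-fromList⁺ {x} (y ∷ ys) (there x∈ys) with x ≟ᶠ y
  ... | yes refl = []≔-updates (fromList ys) y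
  ... | no x≢y = []≔-minimal (fromList ys) x y x≢y (∈-fromList⁺ ys x∈ys)

∣p[x]≔inside∣≤1+∣p∣ : ∀ {n} (p : Subset n) x → ∣ p [ x ]≔ inside ∣ ≤ suc ∣ p ∣
∣p[x]≔inside∣≤1+∣p∣ (inside ∷ p)  fzero       = n≤1+n _
∣p[x]≔inside∣≤1+∣p∣ (outside ∷ p) fzero       = ≤-refl
∣p[x]≔inside∣≤1+∣p∣ (inside ∷ p)  (Fin.suc x) = s≤s (∣p[x]≔inside∣≤1+∣p∣ p x)
∣p[x]≔inside∣≤1+∣p∣ (outside ∷ p) (Fin.suc x) = ∣p[x]≔inside∣≤1+∣p∣ p x

∣fromList∣≤length : ∀ {n} (xs : List (Fin n)) → ∣ fromList xs ∣ ≤ List.length xs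
∣fromList∣≤length {n} [] = ≤-reflexive (∣⊥∣≡0 n)
∣fromList∣≤length (x ∷ xs) =
  ≤-trans (∣p[x]≔inside∣≤1+∣p∣ (fromList xs) x) (s≤s (∣fromList∣≤length xs))

length≤∣∣ : ∀ {n} {xs : List (Fin n)} {M} → Unique xs → All (_∈ M) xs → List.length xs ≤ ∣ M ∣
length≤∣∣ [] [] = z≤n
length≤∣∣ (x∉xs ∷ unique) (x∈M ∷ xs⊆M) =
  ≤-<-trans (length≤∣∣ unique (All.zipWith (λ (y∈M , x≢y) → x∈p∧x≢y⇒x∈p-y y∈M (x≢y ∘ sym)) (xs⊆M , x∉xs)))
            (x∈p⇒∣p-x∣<∣p∣ x∈M)

-- Searching sequences of naturals and Booleans

least : ∀ {P : ℕ → Set} → (∀ k → Dec (P k)) → ∀ {K} → P K →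
        Σ[ k ∈ ℕ ] (P k × (∀ {j} → j < k → ¬ P j))
least P? {zero} p = 0 , p , λ ()
least P? {suc K} p with P? 0
... | yes p₀ = 0 , p₀ , λ ()
... | no ¬p₀ with least (P? ∘ suc) p
...   | k , pk , below = suc k , pk , λ { {zero} _ → ¬p₀ ; {suc j} (s≤s j<k) → below j<k }

lastFalse : ∀ (f : ℕ → Bool) d → f 0 ≡ false →
            Σ[ p ∈ ℕ ] (p ≤ d × f p ≡ false × (∀ {r} → p < r → r ≤ d → f r ≡ true))
lastFalse f zero f0 = 0 , z≤n , f0 , λ 0<r r≤0 → contradiction (<-≤-trans 0<r r≤0) λ ()
lastFalse f (suc d) f0 with f (suc d) in fd
... | false = suc d , ≤-refl , fd , λ p<r r≤p → contradiction (<-≤-trans p<r r≤p) (<-irrefl refl)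
... | true with lastFalse f d f0
...   | p , p≤d , fp , after =
  p , m≤n⇒m≤1+n p≤d , fp , λ p<r r≤1+d →
    [ after p<r ∘ m<1+n⇒m≤n , (λ { refl → fd }) ]′ (m≤n⇒m<n∨m≡n r≤1+d)

firstFalse : ∀ (f : ℕ → Bool) i d → f (i + d) ≡ false →
             Σ[ q ∈ ℕ ] (i ≤ q × q ≤ i + d × f q ≡ false × (∀ {r} → i ≤ r → r < q → f r ≡ true))
firstFalse f i d fi+d with f i in fi
... | false = i , ≤-refl , m≤m+n i d , fi , λ i≤r r<i → contradiction (≤-<-trans i≤r r<i) (<-irrefl refl)
firstFalse f i zero fi+0 | true = ⊥-elim (true≢false fi (subst (λ r → f r ≡ false) (+-identityʳ i) fi+0))
firstFalse f i (suc d) fi+d | true with firstFalse f (suc i) d (subst (λ r → f r ≡ false) (+-suc i d) fi+d)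
... | q , i<q , q≤ , fq , before =
  q , <⇒≤ i<q , ≤-trans q≤ (≤-reflexive (sym (+-suc i d))) , fq , λ i≤r r<q →
    [ (λ i<r → before i<r r<q) , (λ { refl → fi }) ]′ (m≤n⇒m<n∨m≡n i≤r)

trueBlock : ∀ (f : ℕ → Bool) {j N} → j ≤ N → f 0 ≡ false → f N ≡ false → f j ≡ true →
  Σ[ p ∈ ℕ ] Σ[ q ∈ ℕ ]
    (p < j × j < q × q ≤ N × f p ≡ false × f q ≡ false × (∀ {r} → p < r → r < q → f r ≡ true))
trueBlock f {j} {N} j≤N f0 fN fj
  with lastFalse f j f0 | firstFalse f j (N ∸ j) (subst (λ r → f r ≡ false) (sym (m+[n∸m]≡n j≤N)) fN)
... | p , p≤j , fp , after | q , j≤q , q≤ , fq , before =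
  p , q , ≤∧≢⇒< p≤j (≢j fp) , ≤∧≢⇒< j≤q (≢j fq ∘ sym) , ≤-trans q≤ (≤-reflexive (m+[n∸m]≡n j≤N)) ,
  fp , fq , λ p<r r<q → [ after p<r , (λ j≤r → before j≤r r<q) ]′ (≤-total _ j)
  where
  ≢j : ∀ {i} → f i ≡ false → i ≢ j
  ≢j fi refl = true≢false fj fi

-- Walks in a digraph

MonitoredBy : ∀ {n} → (Fin n → Fin n → Set) → Subset n → Fin n → Fin n → Set
MonitoredBy E M u v = ∃[ x ] ∃[ y ] (x ∈ M × y ∈ M × Monitors E x y u v)

HasShortestPaths : ∀ {n} → (Fin n → Fin n → Set) → Set
HasShortestPaths E = ∀ {x y k} → Path E x y k → Σ[ k′ ∈ ℕ ] Σ (Path E x y k′) (Shortest E)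

module _ {n : ℕ} {E : Fin n → Fin n → Set} where

  infixl 5 _∷ʳ_
  _∷ʳ_ : ∀ {x y z k} → Walk E x y k → E y z → Walk E x z (suc k)
  [] ∷ʳ e = e ∷ []
  (f ∷ w) ∷ʳ e = f ∷ (w ∷ʳ e)

  verts-∷ʳ : ∀ {x y z k} (w : Walk E x y k) (e : E y z) → verts E (w ∷ʳ e) ≡ verts E w List.∷ʳ z
  verts-∷ʳ [] e = refl
  verts-∷ʳ (f ∷ w) e = cong (_ ∷_) (verts-∷ʳ w e)

  arcOn-∷ʳ⁺ : ∀ {u v x y z k} {w : Walk E x y k} (e : E y z) →
              ArcOn E u v w → ArcOn E u v (w ∷ʳ e)
  arcOn-∷ʳ⁺ e (here f w) = here f (w ∷ʳ e)
  arcOn-∷ʳ⁺ e (there f a) = there f (arcOn-∷ʳ⁺ e a)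

  arcOn-∷ʳ-last : ∀ {x y z k} (w : Walk E x y k) (e : E y z) → ArcOn E y z (w ∷ʳ e)
  arcOn-∷ʳ-last [] e = here e []
  arcOn-∷ʳ-last (f ∷ w) e = there f (arcOn-∷ʳ-last w e)

  arcOn-∷ʳ⁻ : ∀ {u v x y z k} (w : Walk E x y k) (e : E y z) →
              ArcOn E u v (w ∷ʳ e) → ArcOn E u v w ⊎ (u ≡ y × v ≡ z)
  arcOn-∷ʳ⁻ [] e (here _ _) = inj₂ (refl , refl)
  arcOn-∷ʳ⁻ (f ∷ w) e (here _ _) = inj₁ (here f w)
  arcOn-∷ʳ⁻ (f ∷ w) e (there _ a) = Sum.map₁ (there f) (arcOn-∷ʳ⁻ w e a)

  arcOn⇒arc : ∀ {u v x y k} {w : Walk E x y k} → ArcOn E u v w → E u v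
  arcOn⇒arc (here e _) = e
  arcOn⇒arc (there _ a) = arcOn⇒arc a

  arcOn⇒∈verts : ∀ {u v x y k} {w : Walk E x y k} → ArcOn E u v w → u ∈ₗ verts E w
  arcOn⇒∈verts (here _ _) = here refl
  arcOn⇒∈verts (there _ a) = there (arcOn⇒∈verts a)

  arcOn-out-unique : ∀ {x y k v v′} (w : Walk E x y k) → Unique (verts E w) →
                     ArcOn E x v w → ArcOn E x v′ w → v ≡ v′
  arcOn-out-unique (e ∷ w) _ (here _ _) (here _ _) = refl
  arcOn-out-unique (e ∷ w) (x∉w ∷ _) (here _ _) (there _ a) = ⊥-elim (All.lookup x∉w (arcOn⇒∈verts a) refl)
  arcOn-out-unique (e ∷ w) (x∉w ∷ _) (there _ a) _ = ⊥-elim (All.lookup x∉w (arcOn⇒∈verts a) refl)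

  arcOn-source : ∀ {s v x y k} {w : Walk E x y k} → IsSource E s → ArcOn E s v w → x ≡ s
  arcOn-source src (here _ _) = refl
  arcOn-source src (there e a) with arcOn-source src a
  ... | refl = ⊥-elim (src _ e)

  arcOn-sink : ∀ {u t x y k} {w : Walk E x y k} → IsSink E t → ArcOn E u t w → y ≡ t
  arcOn-sink snk (here _ []) = refl
  arcOn-sink snk (here _ (e ∷ _)) = ⊥-elim (snk _ e)
  arcOn-sink snk (there _ a) = arcOn-sink snk a

  onAllShortest-resp : ∀ {x x′ y y′ u u′ v v′} → x ≡ x′ → y ≡ y′ → u ≡ u′ → v ≡ v′ →
                       OnAllShortest E x y u v → OnAllShortest E x′ y′ u′ v′
  onAllShortest-resp refl refl refl refl = id

  magIs-intro : ∀ {c} → Σ[ M ∈ Subset n ] (IsMAGSet E M × ∣ M ∣ ≤ c) →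
                (∀ M → IsMAGSet E M → c ≤ ∣ M ∣) → MagIs E c
  magIs-intro (M , mag , ∣M∣≤c) lower = (M , mag , ≤-antisym ∣M∣≤c (lower M mag)) , lower

  magIs-fromList : ∀ xs → IsMAGSet E (fromList xs) →
                   (∀ M → IsMAGSet E M → List.length xs ≤ ∣ M ∣) → MagIs E (List.length xs)
  magIs-fromList xs mag = magIs-intro (fromList xs , mag , ∣fromList∣≤length xs)

  two≤∣MAGSet∣ : ∀ {u v M} → E u v → IsMAGSet E M → 2 ≤ ∣ M ∣
  two≤∣MAGSet∣ e mag with mag _ _ e
  ... | x , y , x∈M , y∈M , x≢y , _ = length≤∣∣ ((x≢y ∷ []) ∷ [] ∷ []) (x∈M ∷ y∈M ∷ [])

  module _ (shortest : HasShortestPaths E) where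

    onAllShortest⇒arcOn : ∀ {x y u v} → OnAllShortest E x y u v →
                          Σ[ K ∈ ℕ ] Σ[ p ∈ Path E x y K ] (Shortest E p × ArcOn E u v (proj₁ p))
    onAllShortest⇒arcOn ((_ , p) , on) with shortest p
    ... | K , q , q-shortest = K , q , q-shortest , on K q q-shortest

    onAllShortest-source : ∀ {x y s v} → IsSource E s → OnAllShortest E x y s v → x ≡ s
    onAllShortest-source src oas with onAllShortest⇒arcOn oas
    ... | _ , _ , _ , s→v = arcOn-source src s→v

    onAllShortest-sink : ∀ {x y u t} → IsSink E t → OnAllShortest E x y u t → y ≡ t
    onAllShortest-sink snk oas with onAllShortest⇒arcOn oas
    ... | _ , _ , _ , u→t = arcOn-sink snk u→t

    onAllShortest-out-unique : ∀ {x y v v′} →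
                               OnAllShortest E x y x v → OnAllShortest E x y x v′ → v ≡ v′
    onAllShortest-out-unique oas oas′ with onAllShortest⇒arcOn oas
    ... | K , p , p-shortest , x→v =
      arcOn-out-unique (proj₁ p) (proj₂ p) x→v (proj₂ oas′ K p p-shortest)

    source-partner : ∀ {M s v} → IsMAGSet E M → IsSource E s → E s v →
                     s ∈ M × Σ[ z ∈ Fin n ] (z ∈ M × z ≢ s × OnAllShortest E s z s v)
    source-partner mag src e with mag _ _ e
    ... | x , y , x∈M , y∈M , x≢y , inj₁ oas with onAllShortest-source src oas
    ...   | refl = x∈M , y , y∈M , x≢y ∘ sym , oas
    source-partner mag src e | x , y , x∈M , y∈M , x≢y , inj₂ oas with onAllShortest-source src oas
    ...   | refl = y∈M , x , x∈M , x≢y , oas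

    sink∈MAGSet : ∀ {M u t} → IsMAGSet E M → IsSink E t → E u t → t ∈ M
    sink∈MAGSet {M} mag snk e with mag _ _ e
    ... | x , y , x∈M , y∈M , _ , inj₁ oas = subst (_∈ M) (onAllShortest-sink snk oas) y∈M
    ... | x , y , x∈M , y∈M , _ , inj₂ oas = subst (_∈ M) (onAllShortest-sink snk oas) x∈M

    module _ {M} (mag : IsMAGSet E M) {s t} (src : IsSource E s) (snk : IsSink E t)
             {u} (u→t : E u t) where

      private
        s≢t : ∀ {w} → E s w → s ≢ t
        s≢t s→w refl = snk _ s→w

        t∈M : t ∈ M
        t∈M = sink∈MAGSet mag snk u→t

      partner-off-shortest : ∀ {K v w} (p : Path E s t K) → Shortest E p → ArcOn E s v (proj₁ p) →
                             E s w → w ≢ v →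
                             Σ[ z ∈ Fin n ] (z ∈ M × z ≢ s × z ≢ t × OnAllShortest E s z s w)
      partner-off-shortest p p-shortest s→v s→w w≢v with source-partner mag src s→w
      ... | _ , z , z∈M , z≢s , oas = z , z∈M , z≢s , z≢t , oas
        where
        z≢t : z ≢ t
        z≢t refl = w≢v (arcOn-out-unique (proj₁ p) (proj₂ p) (proj₂ oas _ p p-shortest) s→v)

      three≤∣MAGSet∣ : ∀ {K v w} (p : Path E s t K) → Shortest E p → ArcOn E s v (proj₁ p) →
                       E s w → w ≢ v → 3 ≤ ∣ M ∣
      three≤∣MAGSet∣ p p-shortest s→v s→w w≢v with partner-off-shortest p p-shortest s→v s→w w≢v
      ... | z , z∈M , z≢s , z≢t , _ =
        length≤∣∣ ((s≢t s→w ∷ z≢s ∘ sym ∷ []) ∷ (z≢t ∘ sym ∷ []) ∷ [] ∷ [])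
                  (proj₁ (source-partner mag src s→w) ∷ t∈M ∷ z∈M ∷ [])

      four≤∣MAGSet∣ : ∀ {K K′ v w} (p : Path E s t K) (q : Path E s t K′) →
                      Shortest E p → Shortest E q →
                      ArcOn E s v (proj₁ p) → ArcOn E s w (proj₁ q) → v ≢ w → 4 ≤ ∣ M ∣
      four≤∣MAGSet∣ p q p-shortest q-shortest s→v s→w v≢w
        with partner-off-shortest q q-shortest s→w (arcOn⇒arc s→v) v≢w
           | partner-off-shortest p p-shortest s→v (arcOn⇒arc s→w) (v≢w ∘ sym)
      ... | z , z∈M , z≢s , z≢t , oas | z′ , z′∈M , z′≢s , z′≢t , oas′ =
        length≤∣∣ ((s≢t (arcOn⇒arc s→v) ∷ z≢s ∘ sym ∷ z′≢s ∘ sym ∷ []) ∷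
                   (z≢t ∘ sym ∷ z′≢t ∘ sym ∷ []) ∷
                   ((λ { refl → v≢w (onAllShortest-out-unique oas oas′) }) ∷ []) ∷ [] ∷ [])
                  (proj₁ (source-partner mag src (arcOn⇒arc s→v)) ∷ t∈M ∷ z∈M ∷ z′∈M ∷ [])

-- Reversing all arcs

module _ {n : ℕ} {E F : Fin n → Fin n → Set} (flip : ∀ {u v} → E u v → F v u) where

  reverseWalk : ∀ {x y k} → Walk E x y k → Walk F y x k
  reverseWalk [] = []
  reverseWalk (e ∷ w) = reverseWalk w ∷ʳ flip e

  verts-reverseWalk : ∀ {x y k} (w : Walk E x y k) → verts F (reverseWalk w) ≡ reverse (verts E w)
  verts-reverseWalk [] = refl
  verts-reverseWalk {x} (e ∷ w) = begin
    verts F (reverseWalk w ∷ʳ flip e)  ≡⟨ verts-∷ʳ (reverseWalk w) (flip e) ⟩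
    verts F (reverseWalk w) List.∷ʳ x  ≡⟨ cong (List._∷ʳ x) (verts-reverseWalk w) ⟩
    reverse (verts E w) List.∷ʳ x      ≡⟨ unfold-reverse x (verts E w) ⟨
    reverse (x ∷ verts E w)            ∎
    where open ≡-Reasoning

  reversePath : ∀ {x y k} → Path E x y k → Path F y x k
  reversePath (w , unique) =
    reverseWalk w ,
    subst Unique (sym (verts-reverseWalk w)) (Unique-resp-↭ (↭-sym (↭-reverse (verts E w))) unique)
    where
    open import Data.List.Relation.Binary.Permutation.Setoid (setoid (Fin n)) using (↭-sym)
    open import Data.List.Relation.Binary.Permutation.Setoid.Properties (setoid (Fin n))
      using (Unique-resp-↭; ↭-reverse)

  arcOn-reverseWalk⁻ : ∀ {x y k u v} (w : Walk E x y k) → ArcOn F v u (reverseWalk w) → ArcOn E u v w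
  arcOn-reverseWalk⁻ (e ∷ w) a with arcOn-∷ʳ⁻ (reverseWalk w) (flip e) a
  ... | inj₁ a′ = there e (arcOn-reverseWalk⁻ w a′)
  ... | inj₂ (refl , refl) = here e w

  source-converse : ∀ {x} → IsSource F x → IsSink E x
  source-converse src w e = src w (flip e)

  sink-converse : ∀ {x} → IsSink F x → IsSource E x
  sink-converse snk u e = snk u (flip e)

module _ {n : ℕ} {E F : Fin n → Fin n → Set}
         (toF : ∀ {u v} → E u v → F v u) (toE : ∀ {u v} → F u v → E v u) where

  onAllShortest-converse : ∀ {x y u v} → OnAllShortest F x y u v → OnAllShortest E y x v u
  onAllShortest-converse ((k , p) , on) =
    (k , reversePath toE p) ,
    λ K q q-shortest → arcOn-reverseWalk⁻ toF (proj₁ q)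
                         (on K (reversePath toF q) (λ K′ q′ → q-shortest K′ (reversePath toE q′)))

  monitoredBy-converse : ∀ {M u v} → MonitoredBy F M u v → MonitoredBy E M v u
  monitoredBy-converse (x , y , x∈M , y∈M , x≢y , oas) =
    x , y , x∈M , y∈M , x≢y , Sum.swap (Sum.map onAllShortest-converse onAllShortest-converse oas)

-- Rotations of Fin (suc m)

module Rotation (m : ℕ) where

  n : ℕ
  n = suc m

  infixl 6 _⊕_
  _⊕_ : Fin n → ℕ → Fin n
  x ⊕ zero = x
  x ⊕ suc k = next (x ⊕ k)

  %-absorbʳ : ∀ a b → (a + b % n) % n ≡ (a + b) % n
  %-absorbʳ a b = begin
    (a + b % n) % n          ≡⟨ %-distribˡ-+ a (b % n) n ⟩
    (a % n + b % n % n) % n  ≡⟨ cong (λ z → (a % n + z) % n) (m%n%n≡m%n b n) ⟩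
    (a % n + b % n) % n      ≡⟨ %-distribˡ-+ a b n ⟨
    (a + b) % n              ∎
    where open ≡-Reasoning

  toℕ-⊕ : ∀ x k → toℕ (x ⊕ k) ≡ (toℕ x + k) % n
  toℕ-⊕ x zero = sym (trans (cong (_% n) (+-identityʳ (toℕ x))) (m<n⇒m%n≡m (toℕ<n x)))
  toℕ-⊕ x (suc k) = begin
    toℕ (next (x ⊕ k))         ≡⟨ toℕ-fromℕ< _ ⟩
    suc (toℕ (x ⊕ k)) % n      ≡⟨ cong (λ z → suc z % n) (toℕ-⊕ x k) ⟩
    (1 + (toℕ x + k) % n) % n  ≡⟨ %-absorbʳ 1 (toℕ x + k) ⟩
    suc (toℕ x + k) % n        ≡⟨ cong (_% n) (+-suc (toℕ x) k) ⟨
    (toℕ x + suc k) % n        ∎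
    where open ≡-Reasoning

  toℕ-fzero⊕ : ∀ {a} → a < n → toℕ (fzero ⊕ a) ≡ a
  toℕ-fzero⊕ {a} a<n = trans (toℕ-⊕ fzero a) (m<n⇒m%n≡m a<n)

  ⊕-⊕ : ∀ x j k → x ⊕ j ⊕ k ≡ x ⊕ (k + j)
  ⊕-⊕ x j zero = refl
  ⊕-⊕ x j (suc k) = cong next (⊕-⊕ x j k)

  next-⊕ : ∀ x k → next x ⊕ k ≡ x ⊕ suc k
  next-⊕ x k = trans (⊕-⊕ x 1 k) (cong (x ⊕_) (+-comm k 1))

  ⊕-n : ∀ x → x ⊕ n ≡ x
  ⊕-n x = toℕ-injective (begin
    toℕ (x ⊕ n)      ≡⟨ toℕ-⊕ x n ⟩
    (toℕ x + n) % n  ≡⟨ [m+n]%n≡m%n (toℕ x) n ⟩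
    toℕ x % n        ≡⟨ m<n⇒m%n≡m (toℕ<n x) ⟩
    toℕ x            ∎)
    where open ≡-Reasoning

  ⊕-mod : ∀ x k → x ⊕ (k % n) ≡ x ⊕ k
  ⊕-mod x k = toℕ-injective (begin
    toℕ (x ⊕ (k % n))      ≡⟨ toℕ-⊕ x (k % n) ⟩
    (toℕ x + k % n) % n    ≡⟨ %-absorbʳ (toℕ x) k ⟩
    (toℕ x + k) % n        ≡⟨ toℕ-⊕ x k ⟨
    toℕ (x ⊕ k)            ∎)
    where open ≡-Reasoning

  ⊕-∸n : ∀ x {k} → n ≤ k → x ⊕ (k ∸ n) ≡ x ⊕ k
  ⊕-∸n x {k} n≤k = begin
    x ⊕ (k ∸ n)      ≡⟨ cong (_⊕ (k ∸ n)) (⊕-n x) ⟨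
    x ⊕ n ⊕ (k ∸ n)  ≡⟨ ⊕-⊕ x n (k ∸ n) ⟩
    x ⊕ (k ∸ n + n)  ≡⟨ cong (x ⊕_) (m∸n+n≡m n≤k) ⟩
    x ⊕ k            ∎
    where open ≡-Reasoning

  ⊕-rebase : ∀ x a → x ⊕ (n ∸ toℕ x + a) ≡ fzero ⊕ a
  ⊕-rebase x a = toℕ-injective (begin
    toℕ (x ⊕ (n ∸ toℕ x + a))      ≡⟨ toℕ-⊕ x (n ∸ toℕ x + a) ⟩
    (toℕ x + (n ∸ toℕ x + a)) % n  ≡⟨ cong (_% n) (+-assoc (toℕ x) (n ∸ toℕ x) a) ⟨
    (toℕ x + (n ∸ toℕ x) + a) % n  ≡⟨ cong (λ z → (z + a) % n) (m+[n∸m]≡n (<⇒≤ (toℕ<n x))) ⟩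
    (n + a) % n                    ≡⟨ cong (_% n) (+-comm n a) ⟩
    (a + n) % n                    ≡⟨ [m+n]%n≡m%n a n ⟩
    a % n                          ≡⟨ toℕ-⊕ fzero a ⟨
    toℕ (fzero ⊕ a)                ∎)
    where open ≡-Reasoning

  ⊕-injective : ∀ {x a b} → a < n → b < n → x ⊕ a ≡ x ⊕ b → a ≡ b
  ⊕-injective {x} {a} {b} a<n b<n x⊕a≡x⊕b = begin
    a                          ≡⟨ toℕ-fzero⊕ a<n ⟨
    toℕ (fzero ⊕ a)            ≡⟨ cong toℕ (rewind a) ⟨
    toℕ (x ⊕ a ⊕ (n ∸ toℕ x))  ≡⟨ cong (λ z → toℕ (z ⊕ (n ∸ toℕ x))) x⊕a≡x⊕b ⟩
    toℕ (x ⊕ b ⊕ (n ∸ toℕ x))  ≡⟨ cong toℕ (rewind b) ⟩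
    toℕ (fzero ⊕ b)            ≡⟨ toℕ-fzero⊕ b<n ⟩
    b                          ∎
    where
    open ≡-Reasoning
    rewind : ∀ c → x ⊕ c ⊕ (n ∸ toℕ x) ≡ fzero ⊕ c
    rewind c = trans (⊕-⊕ x c (n ∸ toℕ x)) (⊕-rebase x c)

  ⊕-surjective : ∀ x v → Σ[ j ∈ ℕ ] (j < n × x ⊕ j ≡ v)
  ⊕-surjective x v = (n ∸ toℕ x + toℕ v) % n , m%n<n (n ∸ toℕ x + toℕ v) n , (begin
    x ⊕ ((n ∸ toℕ x + toℕ v) % n)  ≡⟨ ⊕-mod x (n ∸ toℕ x + toℕ v) ⟩
    x ⊕ (n ∸ toℕ x + toℕ v)        ≡⟨ ⊕-rebase x (toℕ v) ⟩
    fzero ⊕ toℕ v                  ≡⟨ toℕ-injective (toℕ-fzero⊕ (toℕ<n v)) ⟩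
    v                              ∎)
    where open ≡-Reasoning

  ⊕-injective-≤ : ∀ {x a b} → a < n → x ⊕ a ≡ x ⊕ b → a ≤ b
  ⊕-injective-≤ {b = b} a<n x⊕a≡x⊕b with b <? n
  ... | yes b<n = ≤-reflexive (⊕-injective a<n b<n x⊕a≡x⊕b)
  ... | no b≮n = ≤-trans (<⇒≤ a<n) (≮⇒≥ b≮n)

  ⊕-full-turn : ∀ {x a b} → 1 ≤ a → a ≤ n → b < n → x ⊕ a ⊕ b ≡ x → a + b ≡ n
  ⊕-full-turn {x} {a} {b} 1≤a a≤n b<n x⊕a⊕b≡x = begin
    a + b        ≡⟨ cong (a +_) (⊕-injective b<n (∸-monoʳ-< 1≤a a≤n) (begin
                      x ⊕ a ⊕ b        ≡⟨ x⊕a⊕b≡x ⟩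
                      x                ≡⟨ ⊕-n x ⟨
                      x ⊕ n            ≡⟨ cong (x ⊕_) (m∸n+n≡m a≤n) ⟨
                      x ⊕ (n ∸ a + a)  ≡⟨ ⊕-⊕ x a (n ∸ a) ⟨
                      x ⊕ a ⊕ (n ∸ a)  ∎)) ⟩
    a + (n ∸ a)  ≡⟨ m+[n∸m]≡n a≤n ⟩
    n            ∎
    where open ≡-Reasoning

  ⊕-split : ∀ {k} → k ≤ n → ∀ x v →
            (Σ[ i ∈ ℕ ] (i < k × v ≡ x ⊕ i)) ⊎ (Σ[ i ∈ ℕ ] (i < n ∸ k × v ≡ x ⊕ k ⊕ i))
  ⊕-split {k} k≤n x v with ⊕-surjective x v
  ... | j , j<n , x⊕j≡v with j <? k
  ...   | yes j<k = inj₁ (j , j<k , sym x⊕j≡v)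
  ...   | no j≮k =
    inj₂ (j ∸ k , ∸-monoˡ-< j<n (≮⇒≥ j≮k) ,
          sym (trans (⊕-⊕ x k (j ∸ k)) (trans (cong (x ⊕_) (m∸n+n≡m (≮⇒≥ j≮k))) x⊕j≡v)))

  next-injective : ∀ {x y} → next x ≡ next y → x ≡ y
  next-injective {x} {y} next-x≡next-y =
    trans (sym (once-round x)) (trans (cong (_⊕ m) next-x≡next-y) (once-round y))
    where
    once-round : ∀ z → next z ⊕ m ≡ z
    once-round z = trans (next-⊕ z m) (⊕-n z)

  next≢id : 1 < n → ∀ x → next x ≢ x
  next≢id 1<n x next-x≡x = contradiction (⊕-injective {x} 1<n z<s next-x≡x) λ ()

  next²≢id : 2 < n → ∀ x → next (next x) ≢ x
  next²≢id 2<n x next²-x≡x = contradiction (⊕-injective {x} 2<n z<s next²-x≡x) λ ()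

-- Oriented cycles

module OrientedCycle {m : ℕ} (2≤m : 2 ≤ m) (o : Fin (suc m) → Bool) where

  open Rotation m

  E : Fin n → Fin n → Set
  E = CArc o

  2<n : 2 < n
  2<n = s≤s 2≤m

  1<n : 1 < n
  1<n = <⇒≤ 2<n

  Run : Bool → Fin n → ℕ → Set
  Run b x k = ∀ {j} → j < k → o (x ⊕ j) ≡ b

  ForwardArcsMonitored : Subset n → Set
  ForwardArcsMonitored M = ∀ {u} → o u ≡ true → MonitoredBy E M u (next u)

  arc-inv : ∀ {u v} → E u v → (v ≡ next u × o u ≡ true) ⊎ (u ≡ next v × o v ≡ false)
  arc-inv (fwd _ p) = inj₁ (refl , p)
  arc-inv (bwd _ p) = inj₂ (refl , p)

  source⇒true : ∀ {v} → IsSource E v → o v ≡ true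
  source⇒true {v} src with o v in ov
  ... | true = refl
  ... | false = ⊥-elim (src (next v) (bwd v ov))

  sink⇒false : ∀ {v} → IsSink E v → o v ≡ false
  sink⇒false {v} snk with o v in ov
  ... | false = refl
  ... | true = ⊥-elim (snk (next v) (fwd v ov))

  source-intro : ∀ {v} → o v ≡ true → (∀ {w} → next w ≡ v → o w ≡ false) → IsSource E v
  source-intro ov before u e with arc-inv e
  ... | inj₁ (v≡next-u , ou) = true≢false ou (before (sym v≡next-u))
  ... | inj₂ (_ , ov′) = true≢false ov ov′

  sink-intro : ∀ {v} → o v ≡ false → (∀ {w} → next w ≡ v → o w ≡ true) → IsSink E v
  sink-intro ov before w e with arc-inv e
  ... | inj₁ (_ , ov′) = true≢false ov′ ov
  ... | inj₂ (v≡next-w , ow) = true≢false (before (sym v≡next-w)) ow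

  runEnd-sink : ∀ {x k} → 1 ≤ k → Run true x k → o (x ⊕ k) ≡ false → IsSink E (x ⊕ k)
  runEnd-sink {x} {suc k} _ run end =
    sink-intro end λ next-w≡ → subst (λ w → o w ≡ true) (sym (next-injective next-w≡)) (run ≤-refl)

  forwardWalk : ∀ {x y} k → y ≡ x ⊕ k → Run true x k → Walk E x y k
  forwardWalk zero refl run = []
  forwardWalk {x} (suc k) refl run =
    forwardWalk k refl (λ j<k → run (m<n⇒m<1+n j<k)) ∷ʳ fwd (x ⊕ k) (run ≤-refl)

  verts-forwardWalk : ∀ {x} k (run : Run true x k) →
                      verts E (forwardWalk k refl run) ≡ applyUpTo (x ⊕_) (suc k)
  verts-forwardWalk zero run = refl
  verts-forwardWalk {x} (suc k) run =
    trans (verts-∷ʳ _ _)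
          (trans (cong (List._∷ʳ (x ⊕ suc k)) (verts-forwardWalk k _)) (applyUpTo-∷ʳ (x ⊕_) (suc k)))

  forwardWalk-arcOn : ∀ {x} k (run : Run true x k) {j} → j < k →
                      ArcOn E (x ⊕ j) (x ⊕ suc j) (forwardWalk k refl run)
  forwardWalk-arcOn (suc k) run j<1+k with m<1+n⇒m<n∨m≡n j<1+k
  ... | inj₁ j<k = arcOn-∷ʳ⁺ _ (forwardWalk-arcOn k _ j<k)
  ... | inj₂ refl = arcOn-∷ʳ-last _ _

  forwardPath : ∀ {x y k} → y ≡ x ⊕ k → k < n → Run true x k → Path E x y k
  forwardPath {x} {k = k} refl k<n run =
    forwardWalk k refl run ,
    subst Unique (sym (verts-forwardWalk k run))
      (applyUpTo⁺₁ (x ⊕_) (suc k) λ i<j j≤k → <⇒≢ i<j ∘ ⊕-injective (<-trans i<j (<n j≤k)) (<n j≤k))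
    where
    <n : ∀ {j} → j < suc k → j < n
    <n j≤k = ≤-<-trans (m<1+n⇒m≤n j≤k) k<n

  forwardPath-arcOn : ∀ {x y k} (y≡x⊕k : y ≡ x ⊕ k) (k<n : k < n) (run : Run true x k) {j} → j < k →
                      ArcOn E (x ⊕ j) (x ⊕ suc j) (proj₁ (forwardPath y≡x⊕k k<n run))
  forwardPath-arcOn refl k<n run = forwardWalk-arcOn _ run

  backwardWalk : ∀ {x y} k → x ≡ y ⊕ k → Run false y k → Walk E x y k
  backwardWalk zero refl run = []
  backwardWalk {y = y} (suc k) refl run =
    bwd (y ⊕ k) (run ≤-refl) ∷ backwardWalk k refl (λ j<k → run (m<n⇒m<1+n j<k))

  verts-backwardWalk : ∀ {y} k (run : Run false y k) →
                       verts E (backwardWalk k refl run) ≡ applyDownFrom (y ⊕_) (suc k)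
  verts-backwardWalk zero run = refl
  verts-backwardWalk {y} (suc k) run = cong (y ⊕ suc k ∷_) (verts-backwardWalk k _)

  backwardPath : ∀ {x y k} → x ≡ y ⊕ k → k < n → Run false y k → Path E x y k
  backwardPath {y = y} {k} refl k<n run =
    backwardWalk k refl run ,
    subst Unique (sym (verts-backwardWalk k run))
      (applyDownFrom⁺₁ (y ⊕_) (suc k) λ j<i i≤k →
         <⇒≢ j<i ∘ sym ∘ ⊕-injective (<n i≤k) (<-trans j<i (<n i≤k)))
    where
    <n : ∀ {i} → i < suc k → i < n
    <n i≤k = ≤-<-trans (m<1+n⇒m≤n i≤k) k<n

  backwardPath-first : ∀ {x y k} (x≡y⊕k : x ≡ y ⊕ k) (k<n : k < n) (run : Run false y k) → 1 ≤ k →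
    Σ[ b ∈ Fin n ] (next b ≡ x × o b ≡ false × ArcOn E x b (proj₁ (backwardPath x≡y⊕k k<n run)))
  backwardPath-first {y = y} {suc k} refl k<n run _ = y ⊕ k , refl , run ≤-refl , here _ _

  IsForward : ∀ {x y K} → Walk E x y K → Set
  IsForward {x} {y} {K} w =
    y ≡ x ⊕ K × Run true x K × (∀ {j} → j < K → ArcOn E (x ⊕ j) (x ⊕ suc j) w)

  IsBackward : ∀ {x y K} → Walk E x y K → Set
  IsBackward {x} {y} {K} w =
    x ≡ y ⊕ K × Run false y K × (∀ {j} → j < K → ArcOn E (y ⊕ suc j) (y ⊕ j) w)

  forward-∷ : ∀ {x y K} (p : o x ≡ true) (w : Walk E (next x) y K) →
              IsForward w → IsForward (fwd x p ∷ w)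
  forward-∷ {x} {K = K} p w (y≡ , run , arcs) = trans y≡ (next-⊕ x K) , run′ , arcs′
    where
    run′ : Run true x (suc K)
    run′ {zero} _ = p
    run′ {suc j} (s≤s j<K) = subst (λ v → o v ≡ true) (next-⊕ x j) (run j<K)
    arcs′ : ∀ {j} → j < suc K → ArcOn E (x ⊕ j) (x ⊕ suc j) (fwd x p ∷ w)
    arcs′ {zero} _ = here (fwd x p) w
    arcs′ {suc j} (s≤s j<K) =
      there (fwd x p) (subst₂ (λ u v → ArcOn E u v w) (next-⊕ x j) (next-⊕ x (suc j)) (arcs j<K))

  backward-∷ : ∀ {z y K} (p : o z ≡ false) (w : Walk E z y K) →
               IsBackward w → IsBackward (bwd z p ∷ w)
  backward-∷ {z} {y} {K} p w (z≡ , run , arcs) = cong next z≡ , run′ , arcs′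
    where
    run′ : Run false y (suc K)
    run′ j<1+K with m<1+n⇒m<n∨m≡n j<1+K
    ... | inj₁ j<K = run j<K
    ... | inj₂ refl = subst (λ v → o v ≡ false) z≡ p
    arcs′ : ∀ {j} → j < suc K → ArcOn E (y ⊕ suc j) (y ⊕ j) (bwd z p ∷ w)
    arcs′ j<1+K with m<1+n⇒m<n∨m≡n j<1+K
    ... | inj₁ j<K = there (bwd z p) (arcs j<K)
    ... | inj₂ refl = subst (λ v → ArcOn E (next v) v (bwd z p ∷ w)) z≡ (here (bwd z p) w)

  backward⇒forward : ∀ {x y K} → o x ≡ true → (w : Walk E (next x) y K) → IsBackward w → IsForward w
  backward⇒forward ox [] _ = refl , (λ ()) , (λ ())
  backward⇒forward ox (_ ∷ _) (next-x≡ , run , _) =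
    ⊥-elim (true≢false ox (subst (λ v → o v ≡ false) (sym (next-injective next-x≡)) (run ≤-refl)))

  forward⇒backward : ∀ {z y K} → o z ≡ false → (w : Walk E z y K) → IsForward w → IsBackward w
  forward⇒backward oz [] _ = refl , (λ ()) , (λ ())
  forward⇒backward oz (_ ∷ _) (_ , run , _) = ⊥-elim (true≢false (run z<s) oz)

  walk-direction : ∀ {x y K} (w : Walk E x y K) → IsForward w ⊎ IsBackward w
  walk-direction [] = inj₁ (refl , (λ ()) , (λ ()))
  walk-direction (fwd x p ∷ w) =
    inj₁ (forward-∷ p w ([ id , backward⇒forward p w ]′ (walk-direction w)))
  walk-direction (bwd z p ∷ w) =
    inj₂ (backward-∷ p w ([ forward⇒backward p w , id ]′ (walk-direction w)))

  Straight : Fin n → Fin n → ℕ → Set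
  Straight x y K = (y ≡ x ⊕ K × Run true x K) ⊎ (x ≡ y ⊕ K × Run false y K)

  walk-straight : ∀ {x y K} → Walk E x y K → Straight x y K
  walk-straight w =
    Sum.map (λ (eq , run , _) → eq , run) (λ (eq , run , _) → eq , run) (walk-direction w)

  straight? : ∀ x y K → Dec (Straight x y K)
  straight? x y K = ((y ≟ᶠ x ⊕ K) ×-dec run? true x) ⊎-dec ((x ≟ᶠ y ⊕ K) ×-dec run? false y)
    where
    run? : ∀ b z → Dec (Run b z K)
    run? b z = allUpTo? (λ j → o (z ⊕ j) Bool.≟ b) K

  straight-∸n : ∀ {x y K} → n ≤ K → Straight x y K → Straight x y (K ∸ n)
  straight-∸n {x} {y} {K} n≤K =
    Sum.map (λ (eq , run) → trans eq (sym (⊕-∸n x n≤K)) , shorten run)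
            (λ (eq , run) → trans eq (sym (⊕-∸n y n≤K)) , shorten run)
    where
    shorten : ∀ {b z} → Run b z K → Run b z (K ∸ n)
    shorten run j< = run (<-≤-trans j< (m∸n≤m K n))

  straight⇒path : ∀ {x y K} → K < n → Straight x y K → Path E x y K
  straight⇒path K<n (inj₁ (y≡x⊕K , run)) = forwardPath y≡x⊕K K<n run
  straight⇒path K<n (inj₂ (x≡y⊕K , run)) = backwardPath x≡y⊕K K<n run

  -- The least straight length is below n, as a straight walk of length K ≥ n shortens to K ∸ n.
  hasShortestPaths : HasShortestPaths E
  hasShortestPaths {x} {y} (w , _) with least (straight? x y) (walk-straight w)
  ... | K , straight , below =
    K , straight⇒path K<n straight , λ K′ p → ≮⇒≥ λ K′<K → below K′<K (walk-straight (proj₁ p))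
    where
    K<n : K < n
    K<n with K <? n
    ... | yes K<n = K<n
    ... | no K≮n = ⊥-elim (below (∸-monoʳ-< z<s (≮⇒≥ K≮n)) (straight-∸n (≮⇒≥ K≮n) straight))

  -- Besides the run itself, the only straight walk from x to x ⊕ k goes backwards round the
  -- rest of the cycle; the hypothesis excludes it as a shortest path.
  forwardRun-onAllShortest : ∀ {x k} → k < n → (run : Run true x k) →
    (∀ {K} → 1 ≤ K → K ≤ k → x ⊕ k ⊕ K ≡ x → ¬ Run false (x ⊕ k) K) →
    ∀ {j} → j < k → OnAllShortest E x (x ⊕ k) (x ⊕ j) (x ⊕ suc j)
  forwardRun-onAllShortest {x} {k} k<n run noReturn {j} j<k = (k , forwardPath refl k<n run) , onShortest
    where
    onShortest : ∀ K (p : Path E x (x ⊕ k) K) → Shortest E p → ArcOn E (x ⊕ j) (x ⊕ suc j) (proj₁ p)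
    onShortest K p p-shortest with walk-direction (proj₁ p)
    ... | inj₁ (x⊕k≡x⊕K , _ , arcs) = arcs (subst (j <_) (⊕-injective k<n K<n x⊕k≡x⊕K) j<k)
      where
      K<n : K < n
      K<n = ≤-<-trans (p-shortest k (forwardPath refl k<n run)) k<n
    ... | inj₂ (x≡x⊕k⊕K , run⁻ , _) =
      ⊥-elim (noReturn 1≤K (p-shortest k (forwardPath refl k<n run)) (sym x≡x⊕k⊕K) run⁻)
      where
      1≤K : 1 ≤ K
      1≤K = n≢0⇒n>0 λ { refl → <⇒≢ (≤-<-trans z≤n j<k) (⊕-injective z<s k<n x≡x⊕k⊕K) }

  record RunThrough (u : Fin n) : Set where
    field
      start           : Fin n
      length offset   : ℕ
      offset<length   : offset < length
      length<n        : length < n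
      run             : Run true start length
      u≡start⊕offset  : u ≡ start ⊕ offset
      start-source    : IsSource E start
      end-sink        : IsSink E (start ⊕ length)

  -- The vertex t with o t ≡ false only serves to stop the run through u from closing up.
  runThrough : ∀ {t u} → o t ≡ false → o u ≡ true → RunThrough u
  runThrough {t} {u} ot ou with ⊕-surjective t u
  ... | j , j<n , t⊕j≡u
    with trueBlock (λ r → o (t ⊕ r)) (<⇒≤ j<n) ot (trans (cong o (⊕-n t)) ot) (trans (cong o t⊕j≡u) ou)
  ... | p , q , p<j , j<q , q≤n , op , oq , between = record
    { start          = t ⊕ suc p
    ; length         = q ∸ suc p
    ; offset         = j ∸ suc p
    ; offset<length  = offset<length
    ; length<n       = <-≤-trans (∸-monoʳ-< z<s 1+p≤q) q≤n
    ; run            = run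
    ; u≡start⊕offset = sym (trans (shift (j ∸ suc p)) (trans (cong (t ⊕_) (m∸n+n≡m p<j)) t⊕j≡u))
    ; start-source   = source-intro (between (n<1+n p) (≤-<-trans p<j j<q))
                         λ next-w≡ → trans (cong o (next-injective next-w≡)) op
    ; end-sink       = runEnd-sink (≤-<-trans z≤n offset<length) run (trans (cong o end) oq)
    }
    where
    1+p≤q : suc p ≤ q
    1+p≤q = <-trans p<j j<q
    shift : ∀ i → t ⊕ suc p ⊕ i ≡ t ⊕ (i + suc p)
    shift = ⊕-⊕ t (suc p)
    offset<length : j ∸ suc p < q ∸ suc p
    offset<length = ∸-monoˡ-< j<q p<j
    run : Run true (t ⊕ suc p) (q ∸ suc p)
    run {i} i< = trans (cong o (shift i))
      (between (m≤n+m (suc p) i) (subst (i + suc p <_) (m∸n+n≡m 1+p≤q) (+-monoˡ-< (suc p) i<)))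
    end : t ⊕ suc p ⊕ (q ∸ suc p) ≡ t ⊕ q
    end = trans (shift (q ∸ suc p)) (cong (t ⊕_) (m∸n+n≡m 1+p≤q))

  -- A unique source s and sink t: the two directed s–t paths are the forward run of length k
  -- and the backward run of length k′.
  record Bipolar (s t : Fin n) : Set where
    field
      k k′    : ℕ
      1≤k     : 1 ≤ k
      1≤k′    : 1 ≤ k′
      k+k′≡n  : k + k′ ≡ n
      t≡s⊕k   : t ≡ s ⊕ k
      s≡t⊕k′  : s ≡ t ⊕ k′
      run⁺    : Run true s k
      run⁻    : Run false t k′

    k<n : k < n
    k<n = subst (k <_) k+k′≡n (m<m+n k 1≤k′)

    k′<n : k′ < n
    k′<n = subst (k′ <_) (trans (+-comm k′ k) k+k′≡n) (m<m+n k′ 1≤k)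

    n∸k≡k′ : n ∸ k ≡ k′
    n∸k≡k′ = trans (cong (_∸ k) (sym k+k′≡n)) (m+n∸m≡n k k′)

    s≢t : s ≢ t
    s≢t s≡t = true≢false (run⁺ 1≤k) (subst (λ v → o v ≡ false) (sym s≡t) (run⁻ 1≤k′))

    t-in : E (next t) t
    t-in = bwd t (run⁻ 1≤k′)

    t-sink : IsSink E t
    t-sink = subst (IsSink E) (sym t≡s⊕k)
                   (runEnd-sink 1≤k run⁺ (subst (λ v → o v ≡ false) t≡s⊕k (run⁻ 1≤k′)))

    sink-unique : ∀ {v} → IsSink E v → v ≡ t
    sink-unique {v} snk with ⊕-split (<⇒≤ k<n) s v
    ... | inj₁ (i , i<k , v≡s⊕i) = ⊥-elim (snk _ (fwd v (trans (cong o v≡s⊕i) (run⁺ i<k))))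
    ... | inj₂ (zero , _ , v≡s⊕k) = trans v≡s⊕k (sym t≡s⊕k)
    ... | inj₂ (suc i , 1+i<n∸k , v≡s⊕k⊕1+i) =
      ⊥-elim (snk _ (subst (λ w → E w (t ⊕ i)) (sym v≡t⊕1+i)
                           (bwd (t ⊕ i) (run⁻ (<-trans (n<1+n i) (subst (suc i <_) n∸k≡k′ 1+i<n∸k))))))
      where
      v≡t⊕1+i : v ≡ t ⊕ suc i
      v≡t⊕1+i = trans v≡s⊕k⊕1+i (cong (_⊕ suc i) (sym t≡s⊕k))

    forwardArc-position : ∀ {u} → o u ≡ true → Σ[ j ∈ ℕ ] (j < k × u ≡ s ⊕ j)
    forwardArc-position {u} ou with ⊕-split (<⇒≤ k<n) s u
    ... | inj₁ position = position
    ... | inj₂ (i , i<n∸k , u≡s⊕k⊕i) =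
      ⊥-elim (true≢false ou (trans (cong o (trans u≡s⊕k⊕i (cong (_⊕ i) (sym t≡s⊕k))))
                                   (run⁻ (subst (i <_) n∸k≡k′ i<n∸k))))

    fwPath : Path E s t k
    fwPath = forwardPath t≡s⊕k k<n run⁺

    bwPath : Path E s t k′
    bwPath = backwardPath s≡t⊕k′ k′<n run⁻

    path-length : ∀ {K} → Path E s t K → k ≤ K ⊎ k′ ≤ K
    path-length p with walk-straight (proj₁ p)
    ... | inj₁ (t≡s⊕K , _) = inj₁ (⊕-injective-≤ k<n (trans (sym t≡s⊕k) t≡s⊕K))
    ... | inj₂ (s≡t⊕K , _) = inj₂ (⊕-injective-≤ k′<n (trans (sym s≡t⊕k′) s≡t⊕K))

    fwPath-shortest : k ≤ k′ → Shortest E fwPath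
    fwPath-shortest k≤k′ _ p = [ id , ≤-trans k≤k′ ]′ (path-length p)

    bwPath-shortest : k′ ≤ k → Shortest E bwPath
    bwPath-shortest k′≤k _ p = [ ≤-trans k′≤k , id ]′ (path-length p)

    s→next-s : ArcOn E s (next s) (proj₁ fwPath)
    s→next-s = forwardPath-arcOn t≡s⊕k k<n run⁺ 1≤k

    private
      s-exit : Σ[ b ∈ Fin n ] (next b ≡ s × o b ≡ false × ArcOn E s b (proj₁ bwPath))
      s-exit = backwardPath-first s≡t⊕k′ k′<n run⁻ 1≤k′

    prev-s : Fin n
    prev-s = proj₁ s-exit

    next-prev-s : next prev-s ≡ s
    next-prev-s = proj₁ (proj₂ s-exit)

    s→prev-s : ArcOn E s prev-s (proj₁ bwPath)
    s→prev-s = proj₂ (proj₂ (proj₂ s-exit))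

    prev-s≢next-s : prev-s ≢ next s
    prev-s≢next-s prev≡next = next²≢id 2<n s (subst (λ v → next v ≡ s) prev≡next next-prev-s)

    s-source : IsSource E s
    s-source = source-intro (run⁺ 1≤k) λ next-w≡s →
      trans (cong o (next-injective (trans next-w≡s (sym next-prev-s)))) (proj₁ (proj₂ (proj₂ s-exit)))

    four≤∣MAGSet∣-balanced : k ≡ k′ → ∀ {M} → IsMAGSet E M → 4 ≤ ∣ M ∣
    four≤∣MAGSet∣-balanced k≡k′ mag =
      four≤∣MAGSet∣ hasShortestPaths mag s-source t-sink t-in fwPath bwPath
        (fwPath-shortest (≤-reflexive k≡k′)) (bwPath-shortest (≤-reflexive (sym k≡k′)))
        s→next-s s→prev-s (prev-s≢next-s ∘ sym)

    three≤∣MAGSet∣-unbalanced : k ≢ k′ → ∀ {M} → IsMAGSet E M → 3 ≤ ∣ M ∣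
    three≤∣MAGSet∣-unbalanced k≢k′ mag with <-cmp k k′
    ... | tri< k<k′ _ _ =
      three≤∣MAGSet∣ hasShortestPaths mag s-source t-sink t-in
        fwPath (fwPath-shortest (<⇒≤ k<k′)) s→next-s (arcOn⇒arc s→prev-s) prev-s≢next-s
    ... | tri≈ _ k≡k′ _ = ⊥-elim (k≢k′ k≡k′)
    ... | tri> _ _ k′<k =
      three≤∣MAGSet∣ hasShortestPaths mag s-source t-sink t-in
        bwPath (bwPath-shortest (<⇒≤ k′<k)) s→prev-s (arcOn⇒arc s→next-s) (prev-s≢next-s ∘ sym)

    balanced⇒2≤k : k ≡ k′ → 2 ≤ k
    balanced⇒2≤k k≡k′ = ≮⇒≥ λ k<2 →
      <⇒≱ 2<n (subst (_≤ 2) k+k′≡n (+-mono-≤ (≤-pred k<2) (subst (_≤ 1) k≡k′ (≤-pred k<2))))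

    forwardArcs-viaEnds : k < k′ → ∀ {M} → s ∈ M → t ∈ M → ForwardArcsMonitored M
    forwardArcs-viaEnds k<k′ s∈M t∈M ou with forwardArc-position ou
    ... | j , j<k , refl =
      s , t , s∈M , t∈M , s≢t ,
      inj₁ (onAllShortest-resp refl (sym t≡s⊕k) refl refl (forwardRun-onAllShortest k<n run⁺ noReturn j<k))
      where
      noReturn : ∀ {K} → 1 ≤ K → K ≤ k → s ⊕ k ⊕ K ≡ s → ¬ Run false (s ⊕ k) K
      noReturn {K} _ K≤k s⊕k⊕K≡s _ = <⇒≱ k<k′ (subst (_≤ k) K≡k′ K≤k)
        where
        K≡k′ : K ≡ k′
        K≡k′ = ⊕-injective (≤-<-trans K≤k k<n) k′<n
                 (trans s⊕k⊕K≡s (trans s≡t⊕k′ (cong (_⊕ k′) t≡s⊕k)))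

    forwardArcs-viaSecond : 2 ≤ k → ∀ {M} → s ∈ M → next s ∈ M → t ∈ M → ForwardArcsMonitored M
    forwardArcs-viaSecond 2≤k s∈M next-s∈M t∈M ou with forwardArc-position ou
    ... | zero , _ , refl =
      s , next s , s∈M , next-s∈M , next≢id 1<n s ∘ sym ,
      inj₁ (forwardRun-onAllShortest 1<n (λ j<1 → run⁺ (<-≤-trans j<1 1≤k)) noReturn z<s)
      where
      noReturn : ∀ {K} → 1 ≤ K → K ≤ 1 → s ⊕ 1 ⊕ K ≡ s → ¬ Run false (s ⊕ 1) K
      noReturn 1≤K K≤1 s⊕1⊕K≡s _ =
        next²≢id 2<n s (subst (λ K → s ⊕ 1 ⊕ K ≡ s) (≤-antisym K≤1 1≤K) s⊕1⊕K≡s)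
    ... | suc j , 1+j<k , refl =
      next s , t , next-s∈M , t∈M , next-s≢t ,
      inj₁ (onAllShortest-resp refl tail-end (next-⊕ s j) (next-⊕ s (suc j))
             (forwardRun-onAllShortest ℓ<n tail-run noReturn
               (≤-pred (subst (suc (suc j) ≤_) (sym 1+ℓ≡k) 1+j<k))))
      where
      ℓ : ℕ
      ℓ = pred k
      1+ℓ≡k : suc ℓ ≡ k
      1+ℓ≡k = suc-pred k ⦃ >-nonZero 1≤k ⦄
      ℓ<n : ℓ < n
      ℓ<n = <-trans (n<1+n ℓ) (subst (_< n) (sym 1+ℓ≡k) k<n)
      tail-run : Run true (next s) ℓ
      tail-run {i} i<ℓ = trans (cong o (next-⊕ s i)) (run⁺ (subst (suc i <_) 1+ℓ≡k (s≤s i<ℓ)))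
      tail-end : next s ⊕ ℓ ≡ t
      tail-end = trans (next-⊕ s ℓ) (trans (cong (s ⊕_) 1+ℓ≡k) (sym t≡s⊕k))
      next-s≢t : next s ≢ t
      next-s≢t next-s≡t = <⇒≢ 2≤k (⊕-injective 1<n k<n (trans next-s≡t t≡s⊕k))
      -- a backward return from t to next s has length k′ + 1 and so passes through the source s
      noReturn : ∀ {K} → 1 ≤ K → K ≤ ℓ → next s ⊕ ℓ ⊕ K ≡ next s → ¬ Run false (next s ⊕ ℓ) K
      noReturn {K} _ K≤ℓ return run⁻′ =
        true≢false (run⁺ 1≤k)
          (trans (cong o s≡t⊕k′) (subst (λ x → o (x ⊕ k′) ≡ false) tail-end (run⁻′ k′<K)))
        where
        K≡1+k′ : K ≡ suc k′
        K≡1+k′ = ⊕-injective (≤-<-trans K≤ℓ ℓ<n) (subst (suc k′ <_) k+k′≡n (+-monoˡ-≤ k′ 2≤k))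
                   (trans (cong (_⊕ K) (sym tail-end)) (trans return (cong next s≡t⊕k′)))
        k′<K : k′ < K
        k′<K = subst (k′ <_) (sym K≡1+k′) (n<1+n k′)

  forwardArcs-viaPoles : ∀ {t₁ t₂} → t₁ ≢ t₂ → IsSink E t₁ → IsSink E t₂ →
                         ∀ {S} → (∀ {x} → IsSource E x ⊎ IsSink E x → x ∈ S) → ForwardArcsMonitored S
  forwardArcs-viaPoles t₁≢t₂ snk₁ snk₂ {S} poles∈S ou =
    subst (λ u → MonitoredBy E S u (next u)) (sym u≡start⊕offset)
      (start , start ⊕ length , poles∈S (inj₁ start-source) , poles∈S (inj₂ end-sink) , start≢end ,
       inj₁ (forwardRun-onAllShortest length<n run noReturn offset<length))
    where
    open RunThrough (runThrough (sink⇒false snk₁) ou)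
    1≤length : 1 ≤ length
    1≤length = ≤-<-trans z≤n offset<length
    start≢end : start ≢ start ⊕ length
    start≢end start≡end = true≢false (run 1≤length) (trans (cong o start≡end) (sink⇒false end-sink))
    -- a backward return would make start and start ⊕ length the only source and sink
    noReturn : ∀ {K} → 1 ≤ K → K ≤ length → start ⊕ length ⊕ K ≡ start → ¬ Run false (start ⊕ length) K
    noReturn {K} 1≤K K≤length return run⁻ =
      t₁≢t₂ (trans (Bipolar.sink-unique β snk₁) (sym (Bipolar.sink-unique β snk₂)))
      where
      β : Bipolar start (start ⊕ length)
      β = record
        { k = length ; k′ = K ; 1≤k = 1≤length ; 1≤k′ = 1≤K
        ; k+k′≡n = ⊕-full-turn 1≤length (<⇒≤ length<n) (≤-<-trans K≤length length<n) return
        ; t≡s⊕k = refl ; s≡t⊕k′ = sym return ; run⁺ = run ; run⁻ = run⁻ }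

  allForward-monitored : (∀ v → o v ≡ true) → ∀ {x M} → x ∈ M → next x ∈ M → ForwardArcsMonitored M
  allForward-monitored allTrue {x} x∈M next-x∈M {u} _ with ⊕-surjective x u
  ... | zero , _ , refl =
    x , next x , x∈M , next-x∈M , next≢id 1<n x ∘ sym ,
    inj₁ (forwardRun-onAllShortest 1<n (λ _ → allTrue _) noReturn z<s)
    where
    noReturn : ∀ {K} → 1 ≤ K → K ≤ 1 → x ⊕ 1 ⊕ K ≡ x → ¬ Run false (x ⊕ 1) K
    noReturn 1≤K _ _ run⁻ = true≢false (allTrue _) (run⁻ 1≤K)
  ... | suc i , 1+i<n , refl =
    next x , x , next-x∈M , x∈M , next≢id 1<n x ,
    inj₁ (onAllShortest-resp refl (trans (next-⊕ x m) (⊕-n x)) (next-⊕ x i) (next-⊕ x (suc i))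
           (forwardRun-onAllShortest ≤-refl (λ _ → allTrue _) noReturn (≤-pred 1+i<n)))
    where
    noReturn : ∀ {K} → 1 ≤ K → K ≤ m → next x ⊕ m ⊕ K ≡ next x → ¬ Run false (next x ⊕ m) K
    noReturn 1≤K _ _ run⁻ = true≢false (allTrue _) (run⁻ 1≤K)

  poleless⇒constant : (∀ v → ¬ IsSource E v × ¬ IsSink E v) → ∀ v → o v ≡ o fzero
  poleless⇒constant noPoles v with ⊕-surjective fzero v
  ... | j , _ , refl = constant j
    where
    step : ∀ x → o (next x) ≡ o x
    step x with o x in ox | o (next x) in onx
    ... | true  | true  = refl
    ... | false | false = refl
    ... | true  | false =
      ⊥-elim (proj₂ (noPoles (next x))
                    (runEnd-sink {x} {1} z<s (λ { {zero} _ → ox ; {suc _} (s≤s ()) }) onx))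
    ... | false | true  =
      ⊥-elim (proj₁ (noPoles (next x))
                    (source-intro onx λ next-w≡ → trans (cong o (next-injective next-w≡)) ox))
    constant : ∀ j → o (fzero ⊕ j) ≡ o fzero
    constant zero = refl
    constant (suc j) = trans (step _) (constant j)

-- The four cases

module MagOfCycle {m : ℕ} (2≤m : 2 ≤ m) (o : Fin (suc m) → Bool) where

  open Rotation m
  open OrientedCycle 2≤m o
  module Rev = OrientedCycle 2≤m (not ∘ o)

  toRev : ∀ {u v} → E u v → Rev.E v u
  toRev (fwd i p) = bwd i (cong not p)
  toRev (bwd i p) = fwd i (cong not p)

  fromRev : ∀ {u v} → Rev.E u v → E v u
  fromRev (fwd i p) = bwd i (not-injective p)
  fromRev (bwd i p) = fwd i (not-injective p)

  -- The backward arcs of o are the forward arcs of not ∘ o, read in the opposite direction.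
  isMAGSet-byDirection : ∀ {M} → ForwardArcsMonitored M → Rev.ForwardArcsMonitored M → IsMAGSet E M
  isMAGSet-byDirection fw bw _ _ (fwd u p) = fw p
  isMAGSet-byDirection fw bw _ _ (bwd v p) = monitoredBy-converse toRev fromRev (bw (cong not p))

  reversed : ∀ {s t} → Bipolar s t → Rev.Bipolar t s
  reversed β = record
    { k = k′ ; k′ = k ; 1≤k = 1≤k′ ; 1≤k′ = 1≤k ; k+k′≡n = trans (+-comm k′ k) k+k′≡n
    ; t≡s⊕k = s≡t⊕k′ ; s≡t⊕k′ = t≡s⊕k
    ; run⁺ = λ j<k′ → cong not (run⁻ j<k′) ; run⁻ = λ j<k → cong not (run⁺ j<k) }
    where open Bipolar β

  bipolar : ∀ {s t} → UniqueSource E s → UniqueSink E t → Bipolar s t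
  bipolar {s} {t} (src , src-unique) (snk , snk-unique) = record
    { k = R.length ; k′ = R′.length ; 1≤k = 1≤k ; 1≤k′ = ≤-<-trans z≤n R′.offset<length
    ; k+k′≡n = ⊕-full-turn 1≤k (<⇒≤ R.length<n) R′.length<n
                 (trans (cong (_⊕ R′.length) (sym t≡s⊕k)) (sym s≡t⊕k′))
    ; t≡s⊕k = t≡s⊕k ; s≡t⊕k′ = s≡t⊕k′
    ; run⁺ = subst (λ x → Run true x R.length) start≡s R.run
    ; run⁻ = subst (λ x → Run false x R′.length) start′≡t (λ j< → not-injective (R′.run j<)) }
    where
    module R = RunThrough (runThrough (sink⇒false snk) (source⇒true src))
    module R′ = Rev.RunThrough (Rev.runThrough (cong not (source⇒true src)) (cong not (sink⇒false snk)))
    1≤k : 1 ≤ R.length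
    1≤k = ≤-<-trans z≤n R.offset<length
    start≡s : R.start ≡ s
    start≡s = src-unique _ R.start-source
    start′≡t : R′.start ≡ t
    start′≡t = snk-unique _ (source-converse {E = E} {F = Rev.E} toRev R′.start-source)
    t≡s⊕k : t ≡ s ⊕ R.length
    t≡s⊕k = trans (sym (snk-unique _ R.end-sink)) (cong (_⊕ R.length) start≡s)
    s≡t⊕k′ : s ≡ t ⊕ R′.length
    s≡t⊕k′ = trans (sym (src-unique _ (sink-converse {E = E} {F = Rev.E} toRev R′.end-sink)))
                   (cong (_⊕ R′.length) start′≡t)

  mag-directed : (∀ v → ¬ IsSource E v × ¬ IsSink E v) → MagIs E 2
  mag-directed noPoles with fromList-⊇ (fzero ∷ next fzero ∷ [])
  ... | 0∈M ∷ 1∈M ∷ [] =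
    magIs-fromList (fzero ∷ next fzero ∷ [])
      (isMAGSet-byDirection
        (λ {u} ou → allForward-monitored (λ v → trans (constant v) (trans (sym (constant u)) ou))
                                         0∈M 1∈M ou)
        (λ {u} ou′ → Rev.allForward-monitored
                       (λ v → trans (cong not (constant v)) (trans (sym (cong not (constant u))) ou′))
                       0∈M 1∈M ou′))
      lower
    where
    constant : ∀ v → o v ≡ o fzero
    constant = poleless⇒constant noPoles
    lower : ∀ M → IsMAGSet E M → 2 ≤ ∣ M ∣
    lower _ mag with o fzero in o₀
    ... | true = two≤∣MAGSet∣ (fwd fzero o₀) mag
    ... | false = two≤∣MAGSet∣ (bwd fzero o₀) mag

  mag-balanced : ∀ s t → UniqueSource E s → UniqueSink E t →
                 (∀ K → Path E s t K → K ≡ n / 2) → MagIs E 4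
  mag-balanced s t us ut half with fromList-⊇ (s ∷ next s ∷ t ∷ next t ∷ [])
  ... | s∈M ∷ next-s∈M ∷ t∈M ∷ next-t∈M ∷ [] =
    magIs-fromList (s ∷ next s ∷ t ∷ next t ∷ [])
      (isMAGSet-byDirection (forwardArcs-viaSecond 2≤k s∈M next-s∈M t∈M)
                            (Rev.Bipolar.forwardArcs-viaSecond (reversed β) 2≤k′ t∈M next-t∈M s∈M))
      (λ _ → four≤∣MAGSet∣-balanced k≡k′)
    where
    β : Bipolar s t
    β = bipolar us ut
    open Bipolar β
    k≡k′ : k ≡ k′
    k≡k′ = trans (half k fwPath) (sym (half k′ bwPath))
    2≤k : 2 ≤ k
    2≤k = balanced⇒2≤k k≡k′
    2≤k′ : 2 ≤ k′
    2≤k′ = subst (2 ≤_) k≡k′ 2≤k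

  mag-unbalanced : ∀ s t → UniqueSource E s → UniqueSink E t →
                   (∀ K → Path E s t K → 2 * K ≢ n) → MagIs E 3
  mag-unbalanced s t us ut notHalf = magIs-intro upper (λ _ → three≤∣MAGSet∣-unbalanced k≢k′)
    where
    β : Bipolar s t
    β = bipolar us ut
    open Bipolar β
    k≢k′ : k ≢ k′
    k≢k′ k≡k′ = notHalf k fwPath (trans (cong (k +_) (trans (+-identityʳ k) k≡k′)) k+k′≡n)
    upper : Σ[ M ∈ Subset n ] (IsMAGSet E M × ∣ M ∣ ≤ 3)
    upper with <-cmp k k′
    ... | tri≈ _ k≡k′ _ = ⊥-elim (k≢k′ k≡k′)
    ... | tri< k<k′ _ _ with fromList-⊇ (s ∷ t ∷ next t ∷ [])
    ...   | s∈M ∷ t∈M ∷ next-t∈M ∷ [] =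
      fromList (s ∷ t ∷ next t ∷ []) ,
      isMAGSet-byDirection
        (forwardArcs-viaEnds k<k′ s∈M t∈M)
        (Rev.Bipolar.forwardArcs-viaSecond (reversed β) (≤-trans (s≤s 1≤k) k<k′) t∈M next-t∈M s∈M) ,
      ∣fromList∣≤length (s ∷ t ∷ next t ∷ [])
    upper | tri> _ _ k′<k with fromList-⊇ (s ∷ next s ∷ t ∷ [])
    ...   | s∈M ∷ next-s∈M ∷ t∈M ∷ [] =
      fromList (s ∷ next s ∷ t ∷ []) ,
      isMAGSet-byDirection
        (forwardArcs-viaSecond (≤-trans (s≤s 1≤k′) k′<k) s∈M next-s∈M t∈M)
        (Rev.Bipolar.forwardArcs-viaEnds (reversed β) k′<k t∈M s∈M) ,
      ∣fromList∣≤length (s ∷ next s ∷ t ∷ [])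

  mag-multipolar : (∃[ s₁ ] ∃[ s₂ ] (s₁ ≢ s₂ × IsSource E s₁ × IsSource E s₂)) →
                   (∃[ t₁ ] ∃[ t₂ ] (t₁ ≢ t₂ × IsSink E t₁ × IsSink E t₂)) →
                   (S : Subset n) → (∀ x → (x ∈ S) ⇔ (IsSource E x ⊎ IsSink E x)) → MagIs E ∣ S ∣
  mag-multipolar (_ , _ , s₁≢s₂ , src₁ , src₂) (_ , _ , t₁≢t₂ , snk₁ , snk₂) S S≡poles =
    magIs-intro (S , isMAGSet-byDirection fw bw , ≤-refl) (λ _ mag → p⊆q⇒∣p∣≤∣q∣ (S⊆ mag))
    where
    poles∈S : ∀ {x} → IsSource E x ⊎ IsSink E x → x ∈ S
    poles∈S = Equivalence.from (S≡poles _)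
    revPoles∈S : ∀ {x} → IsSource Rev.E x ⊎ IsSink Rev.E x → x ∈ S
    revPoles∈S = poles∈S ∘ Sum.swap ∘ Sum.map (source-converse {E = E} {F = Rev.E} toRev)
                                              (sink-converse {E = E} {F = Rev.E} toRev)
    fw : ForwardArcsMonitored S
    fw = forwardArcs-viaPoles t₁≢t₂ snk₁ snk₂ poles∈S
    bw : Rev.ForwardArcsMonitored S
    bw = Rev.forwardArcs-viaPoles s₁≢s₂ (source-converse {E = Rev.E} {F = E} fromRev src₁)
                                        (source-converse {E = Rev.E} {F = E} fromRev src₂) revPoles∈S
    S⊆ : ∀ {M} → IsMAGSet E M → S ⊆ M
    S⊆ mag x∈S with Equivalence.to (S≡poles _) x∈S
    ... | inj₁ src = proj₁ (source-partner hasShortestPaths mag src (fwd _ (source⇒true src)))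
    ... | inj₂ snk = sink∈MAGSet hasShortestPaths mag snk (bwd _ (sink⇒false snk))

proposition4 : (n : ℕ) → 3 ≤ n → (o : Fin n → Bool) →
    ((∀ v → ¬ IsSource (CArc o) v × ¬ IsSink (CArc o) v) → MagIs (CArc o) 2)
    × (n % 2 ≡ 0 → (s t : Fin n) → UniqueSource (CArc o) s → UniqueSink (CArc o) t →
         (∀ k → Path (CArc o) s t k → k ≡ n / 2) → MagIs (CArc o) 4)
    × ((s t : Fin n) → UniqueSource (CArc o) s → UniqueSink (CArc o) t →
         (∀ k → Path (CArc o) s t k → 2 * k ≢ n) → MagIs (CArc o) 3)
    × ((∃[ s₁ ] ∃[ s₂ ] (s₁ ≢ s₂ × IsSource (CArc o) s₁ × IsSource (CArc o) s₂)) →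
       (∃[ t₁ ] ∃[ t₂ ] (t₁ ≢ t₂ × IsSink (CArc o) t₁ × IsSink (CArc o) t₂)) →
       (S : Subset n) → (∀ x → (x ∈ S) ⇔ (IsSource (CArc o) x ⊎ IsSink (CArc o) x)) →
       MagIs (CArc o) ∣ S ∣)
proposition4 (suc m) (s≤s 2≤m) o = mag-directed , (λ _ → mag-balanced) , mag-unbalanced , mag-multipolar
  where open MagOfCycle 2≤m o
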